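{- Let $G$ be a graph and $X,Y$ disjoint subsets of $V(G)$ such that $G$ is $X$–$Y$ normalized. Let $S\subseteq N(X)$ and assume that no vertex of $S$ is adjacent to a vertex of $Y$. Then there is $S'\subseteq S$ such that $|S'|\le CE(S)$ and $K(S')=K(S)$.
   Context: All graphs are finite, simple and undirected. $G\setminus C$ is the subgraph induced by $V(G)\setminus C$; $N(C)=(\bigcup_{v\in C}N(v))\setminus C$. An $X$–$Y$ separator is a set $K\subseteq V(G)\setminus(X\cup Y)$ such that $G\setminus K$ has no path from $X$ to $Y$; minimal means inclusion-minimal, smallest means of minimum cardinality. $NR(G,A,B)$ is the set of vertices of $G\setminus B$ not reachable from $A$ in $G\setminus B$. $K'>K$ means $NR(G,Y,K')\supsetneq NR(G,Y,K)$. A minimal $X$–$Y$ separator $K$ is important if no $X$–$Y$ separator $K'$ satisfies $K'>K$ and $|K'|\le|K|$. The excess of an $X$–$Y$ separator $K$ is $|K|-r$, where $r$ is the minimum size of an $X$–$Y$ separator. $G$ is $X$–$Y$ normalized if $N(X)$ is the only smallest $X$–$Y$ separator. For $S\subseteq N(X)$ not adjacent to $Y$, the cover excess $CE(S)$ is the excess of a smallest $X$–$Y$ separator disjoint from $S$; a witness of $S$ is an $X$–$Y$ separator $K$ with $S\cap K=\emptyset$ and excess $CE(S)$; an important witness of $S$ is a witness that is an important $X$–$Y$ separator; there is exactly one, denoted $K(S)$. -}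

module Defs where

open import Data.Nat using (ℕ; _+_; _≤_)
open import Data.Bool using (Bool; T)
open import Data.Fin using (Fin)
open import Data.Fin.Subset using (Subset; _∈_; _∉_; _⊆_; _⊂_; ∣_∣)
open import Data.Product using (Σ; ∃; ∃-syntax; _×_)
open import Relation.Nullary using (¬_)
open import Relation.Binary.PropositionalEquality using (_≡_)

record Graph (n : ℕ) : Set where
  field
    adj    : Fin n → Fin n → Bool
    sym    : ∀ u v → adj u v ≡ adj v u
    irrefl : ∀ v → ¬ T (adj v v)

module _ {n : ℕ} (G : Graph n) where
  open Graph G

  Adj : Fin n → Fin n → Set
  Adj u v = T (adj u v)

  InN : Subset n → Fin n → Set
  InN C v = v ∉ C × ∃[ u ] (u ∈ C × Adj u v)

  data Walk (K : Subset n) : Fin n → Fin n → Set where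
    nil  : ∀ {v} → v ∉ K → Walk K v v
    cons : ∀ {u v w} → u ∉ K → Adj u v → Walk K v w → Walk K u w

  Sep : Subset n → Subset n → Subset n → Set
  Sep X Y K = (∀ v → v ∈ K → v ∉ X × v ∉ Y)
            × (∀ x y → x ∈ X → y ∈ Y → ¬ Walk K x y)

  MinimalSep : Subset n → Subset n → Subset n → Set
  MinimalSep X Y K = Sep X Y K × (∀ K' → K' ⊂ K → ¬ Sep X Y K')

  SmallestSep : Subset n → Subset n → Subset n → Set
  SmallestSep X Y K = Sep X Y K × (∀ K' → Sep X Y K' → ∣ K ∣ ≤ ∣ K' ∣)

  NR : Subset n → Subset n → Fin n → Set
  NR A B v = v ∉ B × (∀ a → a ∈ A → ¬ Walk B a v)

  Greater : Subset n → Subset n → Subset n → Set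
  Greater Y K' K = (∀ v → NR Y K v → NR Y K' v) × ∃[ v ] (NR Y K' v × ¬ NR Y K v)

  ImportantSep : Subset n → Subset n → Subset n → Set
  ImportantSep X Y K = MinimalSep X Y K
    × (∀ K' → Sep X Y K' → Greater Y K' K → ¬ (∣ K' ∣ ≤ ∣ K ∣))

  MinSepSize : Subset n → Subset n → ℕ → Set
  MinSepSize X Y r = (∃[ K ] (Sep X Y K × ∣ K ∣ ≡ r)) × (∀ K → Sep X Y K → r ≤ ∣ K ∣)

  Excess : Subset n → Subset n → Subset n → ℕ → Set
  Excess X Y K e = Sep X Y K × ∃[ r ] (MinSepSize X Y r × ∣ K ∣ ≡ r + e)

  IsN : Subset n → Subset n → Set
  IsN C K = ∀ v → (v ∈ K → InN C v) × (InN C v → v ∈ K)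

  Normalized : Subset n → Subset n → Set
  Normalized X Y = (∃[ K ] (IsN X K × SmallestSep X Y K))
                 × (∀ K → SmallestSep X Y K → IsN X K)

  DisjointS : Subset n → Subset n → Set
  DisjointS A B = ∀ v → v ∈ A → v ∉ B

  CE : Subset n → Subset n → Subset n → ℕ → Set
  CE X Y S c = (∃[ K ] (DisjointS S K × Excess X Y K c))
             × (∀ K e → DisjointS S K → Excess X Y K e → c ≤ e)

  Witness : Subset n → Subset n → Subset n → Subset n → Set
  Witness X Y S K = Sep X Y K × DisjointS S K × ∃[ c ] (CE X Y S c × Excess X Y K c)

  ImportantWitness : Subset n → Subset n → Subset n → Subset n → Set
  ImportantWitness X Y S K = Witness X Y S K × ImportantSep X Y K

module Submission where

-- Call C ⊆ V(G) an X-side if X ⊆ C, C avoids Y and N(C) avoids Y; then N(C)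
-- is an X–Y separator, and every separator K contains N(D) for the X-side D = NR(G,Y,K).
-- Say C covers T if C is an X-side containing T.  Fix a smallest separator (of size r) and
-- let m be the least |N(C)| over covers C of S.  Call T ⊆ S tight if every cover of T also
-- has |N(C)| ≥ m, and let C* be a cover of S of maximum size with |N(C*)| = m.  For every
-- tight T ⊆ S the separator N(C*) is the important witness of T and CE(T) = m - r =: c.
-- It remains to find a tight S' ⊆ S with |S'| ≤ c.  Remove vertices from S while the set
-- stays tight.  If T is tight but no T - s is, uncrossing the covers of the sets T - s with
-- the submodularity of C ↦ |N(C)| yields an X-side C with |N(C)| + |T| ≤ m; as N(C) is a
-- separator, r + |T| ≤ m, i.e. |T| ≤ c.

open import Defs
open import Data.Nat using (ℕ; zero; suc; _≤_; _<_; _+_; _∸_; z≤n; _≤?_; _<?_)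
open import Data.Nat.Properties hiding (_≟_)
open import Data.Nat.Tactic.RingSolver using (solve-∀)
open import Data.Bool using (T)
open import Data.Fin using (Fin; zero; suc; _≟_)
open import Data.Fin.Subset
  using (Subset; _∈_; _∉_; _⊆_; _⊂_; ∣_∣; inside; outside; _∩_; _∪_; _-_; ⁅_⁆)
open import Data.Fin.Subset.Properties
  using (_∈?_; _⊆?_; anySubset?; nonempty?; Empty-unique; ∣⊥∣≡0; ∣⁅x⁆∣≡1; ∣p∣≤n;
         p⊆q⇒∣p∣≤∣q∣; p⊂q⇒∣p∣<∣q∣; p─q⊆p; x∈⁅x⁆; x∈p∧x≢y⇒x∈p-y; x∈p⇒∣p-x∣<∣p∣;
         x∈p∪q⁺; x∈p∪q⁻; x∈p∩q⁺; x∈p∩q⁻)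
open import Data.Fin.Properties using (any?; all?)
open import Data.Vec using (_∷_; []; here; there)
open import Data.Product using (∃-syntax; _×_; _,_; proj₁; proj₂)
open import Data.Sum using (_⊎_; inj₁; inj₂; [_,_]′)
import Data.Sum as Sum
open import Data.Empty using (⊥-elim)
open import Function using (_∘_; id)
open import Relation.Nullary using (¬_; Dec; yes; no; does)
open import Relation.Nullary.Decidable using (_×-dec_; _→-dec_; ¬?; T?; decidable-stable; ¬¬-excluded-middle)
open import Relation.Nullary.Negation using (¬¬-map)
open import Relation.Binary.PropositionalEquality using (_≡_; refl; sym; trans; cong; subst)

+-suc-both : ∀ a b c d → a + b ≡ c + d → a + suc b ≡ c + suc d
+-suc-both a b c d eq = trans (+-suc a b) (trans (cong suc eq) (sym (+-suc c d)))

∣p∩q∣+∣p∪q∣≡∣p∣+∣q∣ : ∀ {n} (p q : Subset n) → ∣ p ∩ q ∣ + ∣ p ∪ q ∣ ≡ ∣ p ∣ + ∣ q ∣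
∣p∩q∣+∣p∪q∣≡∣p∣+∣q∣ [] [] = refl
∣p∩q∣+∣p∪q∣≡∣p∣+∣q∣ (outside ∷ p) (outside ∷ q) = ∣p∩q∣+∣p∪q∣≡∣p∣+∣q∣ p q
∣p∩q∣+∣p∪q∣≡∣p∣+∣q∣ (outside ∷ p) (inside ∷ q) = +-suc-both _ _ _ _ (∣p∩q∣+∣p∪q∣≡∣p∣+∣q∣ p q)
∣p∩q∣+∣p∪q∣≡∣p∣+∣q∣ (inside ∷ p) (outside ∷ q) =
  trans (+-suc _ _) (cong suc (∣p∩q∣+∣p∪q∣≡∣p∣+∣q∣ p q))
∣p∩q∣+∣p∪q∣≡∣p∣+∣q∣ (inside ∷ p) (inside ∷ q) =
  cong suc (+-suc-both _ _ _ _ (∣p∩q∣+∣p∪q∣≡∣p∣+∣q∣ p q))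

∣p∣+∣q∣-mono : ∀ {n} {p q r s : Subset n} → p ∩ q ⊆ r ∩ s → p ∪ q ⊆ r ∪ s
             → ∣ p ∣ + ∣ q ∣ ≤ ∣ r ∣ + ∣ s ∣
∣p∣+∣q∣-mono {p = p} {q} {r} {s} ∩⊆ ∪⊆ = begin
  ∣ p ∣ + ∣ q ∣          ≡⟨ sym (∣p∩q∣+∣p∪q∣≡∣p∣+∣q∣ p q) ⟩
  ∣ p ∩ q ∣ + ∣ p ∪ q ∣  ≤⟨ +-mono-≤ (p⊆q⇒∣p∣≤∣q∣ ∩⊆) (p⊆q⇒∣p∣≤∣q∣ ∪⊆) ⟩
  ∣ r ∩ s ∣ + ∣ r ∪ s ∣  ≡⟨ ∣p∩q∣+∣p∪q∣≡∣p∣+∣q∣ r s ⟩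
  ∣ r ∣ + ∣ s ∣          ∎
  where open ≤-Reasoning

∣p∣≤1+∣p-x∣ : ∀ {n} (p : Subset n) x → ∣ p ∣ ≤ suc ∣ p - x ∣
∣p∣≤1+∣p-x∣ p x = begin
  ∣ p ∣                                      ≤⟨ p⊆q⇒∣p∣≤∣q∣ split ⟩
  ∣ (p - x) ∪ ⁅ x ⁆ ∣                        ≤⟨ m≤n+m _ _ ⟩
  ∣ (p - x) ∩ ⁅ x ⁆ ∣ + ∣ (p - x) ∪ ⁅ x ⁆ ∣  ≡⟨ ∣p∩q∣+∣p∪q∣≡∣p∣+∣q∣ (p - x) ⁅ x ⁆ ⟩
  ∣ p - x ∣ + ∣ ⁅ x ⁆ ∣                      ≡⟨ cong (∣ p - x ∣ +_) (∣⁅x⁆∣≡1 x) ⟩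
  ∣ p - x ∣ + 1                              ≡⟨ +-comm _ 1 ⟩
  suc ∣ p - x ∣                              ∎
  where
  open ≤-Reasoning
  split : p ⊆ (p - x) ∪ ⁅ x ⁆
  split {y} y∈p with y ≟ x
  ... | yes refl = x∈p∪q⁺ (inj₂ (x∈⁅x⁆ x))
  ... | no y≢x   = x∈p∪q⁺ (inj₁ (x∈p∧x≢y⇒x∈p-y y∈p y≢x))

∣p-x∣≤ : ∀ {n k} {p : Subset n} {x} → x ∈ p → ∣ p ∣ ≤ suc k → ∣ p - x ∣ ≤ k
∣p-x∣≤ x∈p ∣p∣≤1+k = ≤-pred (≤-trans (x∈p⇒∣p-x∣<∣p∣ x∈p) ∣p∣≤1+k)

member⇒∣p∣≰0 : ∀ {n} {p : Subset n} {x} → x ∈ p → ¬ ∣ p ∣ ≤ 0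
member⇒∣p∣≰0 x∈p ∣p∣≤0 = <⇒≱ (≤-trans (x∈p⇒∣p-x∣<∣p∣ x∈p) ∣p∣≤0) z≤n

x∉p-x : ∀ {n} (p : Subset n) x → x ∉ p - x
x∉p-x (b ∷ p) zero    ()
x∉p-x (b ∷ p) (suc x) (there x∈p-x) = x∉p-x p x x∈p-x

subsetOf : ∀ {n} {P : Fin n → Set} → (∀ v → Dec (P v)) → Subset n
subsetOf {zero}  P? = []
subsetOf {suc n} P? = does (P? zero) ∷ subsetOf (P? ∘ suc)

∈-subsetOf⁻ : ∀ {n} {P : Fin n → Set} (P? : ∀ v → Dec (P v)) {v} → v ∈ subsetOf P? → P v
∈-subsetOf⁻ P? {zero} v∈ with P? zero
... | yes p = p
∈-subsetOf⁻ P? {zero} () | no _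
∈-subsetOf⁻ P? {suc v} (there v∈) = ∈-subsetOf⁻ (P? ∘ suc) v∈

∈-subsetOf⁺ : ∀ {n} {P : Fin n → Set} (P? : ∀ v → Dec (P v)) {v} → P v → v ∈ subsetOf P?
∈-subsetOf⁺ P? {zero} p with P? zero
... | yes _ = here
... | no ¬p = ⊥-elim (¬p p)
∈-subsetOf⁺ P? {suc v} p = there (∈-subsetOf⁺ (P? ∘ suc) p)

-- Inside a proof of
-- a negated (or decidable) goal this lets us form the subset of vertices reachable in some
-- sense without proving reachability decidable.
¬¬-decidable : ∀ {n} (P : Fin n → Set) → ¬ ¬ (∀ v → Dec (P v))
¬¬-decidable {zero}  P k = k (λ ())
¬¬-decidable {suc n} P k = ¬¬-excluded-middle λ P₀? → ¬¬-decidable (P ∘ suc) λ Pₛ? →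
  k λ { zero → P₀? ; (suc v) → Pₛ? v }

minimiser : ∀ {n} (P : Subset n → Set) → (∀ C → Dec (P C)) → (f : Subset n → ℕ)
          → ∀ {C₀} → P C₀ → ∃[ C ] (P C × (∀ C' → P C' → f C ≤ f C'))
minimiser P P? f {C₀} p₀ = descend (f C₀) p₀ ≤-refl
  where
  -- Jump to a strictly better member while one exists; the measure bounds the number of jumps.
  descend : ∀ k {C} → P C → f C ≤ k → ∃[ C' ] (P C' × (∀ C'' → P C'' → f C' ≤ f C''))
  descend k {C} pC fC≤k with anySubset? (λ C' → P? C' ×-dec (f C' <? f C))
  ... | no none = C , pC , λ C' pC' → ≮⇒≥ (λ fC'<fC → none (C' , pC' , fC'<fC))
  descend zero    pC fC≤0 | yes (C' , _ , fC'<fC) = ⊥-elim (<⇒≱ (≤-trans fC'<fC fC≤0) z≤n)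
  descend (suc k) pC fC≤k | yes (C' , pC' , fC'<fC) = descend k pC' (≤-pred (≤-trans fC'<fC fC≤k))

largest : ∀ {n} (P : Subset n → Set) → (∀ C → Dec (P C))
        → ∀ {C₀} → P C₀ → ∃[ C ] (P C × (∀ C' → P C' → ∣ C' ∣ ≤ ∣ C ∣))
largest {n} P P? p₀ with minimiser P P? (λ C → n ∸ ∣ C ∣) p₀
... | C , pC , least-gap = C , pC , λ C' pC' → ∸-cancelʳ-≤ (∣p∣≤n C') (least-gap C' pC')

-- The arithmetic of one uncrossing step: from |N(C₁)| + z ≤ m, |N(C₂)| < m,
-- m ≤ |N(C₁ ∪ C₂)| and submodularity we get |N(C₁ ∩ C₂)| + (z + 1) ≤ m.
uncross-arith : ∀ {i u a b z m} → a + z ≤ m → b < m → m ≤ u → i + u ≤ a + b → i + suc z ≤ m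
uncross-arith {i} {u} {a} {b} {z} {m} a+z≤m b<m m≤u submod = +-cancelʳ-≤ m _ _ (begin
  (i + suc z) + m  ≤⟨ +-monoʳ-≤ (i + suc z) m≤u ⟩
  (i + suc z) + u  ≡⟨ swap i z u ⟩
  (i + u) + suc z  ≤⟨ +-monoˡ-≤ (suc z) submod ⟩
  (a + b) + suc z  ≡⟨ swap′ a b z ⟩
  (a + z) + suc b  ≤⟨ +-mono-≤ a+z≤m b<m ⟩
  m + m            ∎)
  where
  open ≤-Reasoning
  swap : ∀ i z u → (i + suc z) + u ≡ (i + u) + suc z
  swap = solve-∀
  swap′ : ∀ a b z → (a + b) + suc z ≡ (a + z) + suc b
  swap′ = solve-∀

module Sides {n : ℕ} (G : Graph n) (X Y : Subset n) where
  open Graph G using (adj) renaming (sym to adj-sym)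

  Adj-sym : ∀ {u v} → Adj G u v → Adj G v u
  Adj-sym {u} {v} = subst T (adj-sym u v)

  module _ {K : Subset n} where
    walk-start : ∀ {u v} → Walk G K u v → u ∉ K
    walk-start (nil u∉K)      = u∉K
    walk-start (cons u∉K _ _) = u∉K

    snoc : ∀ {u v w} → Walk G K u v → w ∉ K → Adj G v w → Walk G K u w
    snoc (nil u∉K)        w∉K v~w = cons u∉K v~w (nil w∉K)
    snoc (cons u∉K u~v p) w∉K v~w = cons u∉K u~v (snoc p w∉K v~w)

    reverse : ∀ {u v} → Walk G K u v → Walk G K v u
    reverse (nil u∉K)        = nil u∉K
    reverse (cons u∉K u~v p) = snoc (reverse p) u∉K (Adj-sym u~v)

  sep⇒no-edge : ∀ {K x y} → Sep G X Y K → x ∈ X → y ∈ Y → ¬ Adj G x y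
  sep⇒no-edge {K} {x} {y} (K-avoids , separates) x∈X y∈Y x~y =
    separates x y x∈X y∈Y (cons x∉K x~y (nil y∉K))
    where
    x∉K : x ∉ K
    x∉K x∈K = proj₁ (K-avoids x x∈K) x∈X
    y∉K : y ∉ K
    y∉K y∈K = proj₂ (K-avoids y y∈K) y∈Y

  sep⇒NX-unreachable : ∀ {K t} → Sep G X Y K → InN G X t → t ∉ K → NR G Y K t
  sep⇒NX-unreachable {K} (K-avoids , separates) (_ , x , x∈X , x~t) t∉K =
    t∉K , λ y y∈Y y⇝t → separates x y x∈X y∈Y (reverse (snoc y⇝t x∉K (Adj-sym x~t)))
    where
    x∉K : x ∉ K
    x∉K x∈K = proj₁ (K-avoids x x∈K) x∈X

  inN? : ∀ C v → Dec (InN G C v)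
  inN? C v = ¬? (v ∈? C) ×-dec any? (λ u → (u ∈? C) ×-dec T? (adj u v))

  nbhd : Subset n → Subset n
  nbhd C = subsetOf (inN? C)

  ∈nbhd⁻ : ∀ C {v} → v ∈ nbhd C → InN G C v
  ∈nbhd⁻ C = ∈-subsetOf⁻ (inN? C)

  ∈nbhd⁺ : ∀ C {v} → InN G C v → v ∈ nbhd C
  ∈nbhd⁺ C = ∈-subsetOf⁺ (inN? C)

  Side : Subset n → Set
  Side C = X ⊆ C × (∀ y → y ∈ Y → y ∉ C) × (∀ v → InN G C v → v ∉ Y)

  side? : ∀ C → Dec (Side C)
  side? C = X ⊆? C ×-dec all? (λ y → (y ∈? Y) →-dec ¬? (y ∈? C))
                   ×-dec all? (λ v → inN? C v →-dec ¬? (v ∈? Y))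

  walk-stays : ∀ {C u w} → u ∈ C → Walk G (nbhd C) u w → w ∈ C
  walk-stays u∈C (nil _) = u∈C
  walk-stays {C} u∈C (cons {v = v} _ u~v p) with v ∈? C
  ... | yes v∈C = walk-stays v∈C p
  ... | no  v∉C = ⊥-elim (walk-start p (∈nbhd⁺ C (v∉C , _ , u∈C , u~v)))

  side-sep : ∀ {C} → Side C → Sep G X Y (nbhd C)
  side-sep {C} (X⊆C , C∩Y=∅ , NC∩Y=∅) =
    (λ v v∈N → let v∈NC = ∈nbhd⁻ C v∈N in (λ v∈X → proj₁ v∈NC (X⊆C v∈X)) , NC∩Y=∅ v v∈NC)
    , λ x y x∈X y∈Y x⇝y → C∩Y=∅ y y∈Y (walk-stays (X⊆C x∈X) x⇝y)

  side⊆NR : ∀ {C} → Side C → ∀ {v} → v ∈ C → NR G Y (nbhd C) v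
  side⊆NR {C} (_ , C∩Y=∅ , _) v∈C =
    (λ v∈N → proj₁ (∈nbhd⁻ C v∈N) v∈C) , λ y y∈Y y⇝v → C∩Y=∅ y y∈Y (walk-stays v∈C (reverse y⇝v))

  nbhd-disjoint : ∀ {C T} → T ⊆ C → DisjointS G T (nbhd C)
  nbhd-disjoint {C} T⊆C v v∈T v∈N = proj₁ (∈nbhd⁻ C v∈N) (T⊆C v∈T)

  -- Every separator K contains N(D) for the X-side D = NR(G,Y,K) (stated doubly negated,
  -- since D is formed from a possibly undecidable reachability predicate).
  NR-side : ∀ {K} → Sep G X Y K
          → ¬ ¬ (∃[ D ] (Side D × nbhd D ⊆ K × (∀ {v} → v ∈ D → NR G Y K v)
                                               × (∀ {v} → NR G Y K v → v ∈ D)))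
  NR-side {K} (K-avoids , separates) = ¬¬-map NR-set (¬¬-decidable (NR G Y K))
    where
    NR-set : (∀ v → Dec (NR G Y K v))
           → ∃[ D ] (Side D × nbhd D ⊆ K × (∀ {v} → v ∈ D → NR G Y K v)
                                          × (∀ {v} → NR G Y K v → v ∈ D))
    NR-set NR? = D , (X⊆D , D∩Y=∅ , λ v v∈ND → proj₂ (K-avoids v (exit∈K (∈nbhd⁺ D v∈ND))))
               , exit∈K , ∈-subsetOf⁻ NR? , ∈-subsetOf⁺ NR?
      where
      D : Subset n
      D = subsetOf NR?
      -- An edge leaving D ends in K: otherwise Y would reach D across it.
      exit∈K : ∀ {v} → v ∈ nbhd D → v ∈ K
      exit∈K {v} v∈ND with v ∈? K | ∈nbhd⁻ D v∈ND
      ... | yes v∈K | _ = v∈K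
      ... | no v∉K | v∉D , u , u∈D , u~v =
        let (u∉K , Y↛u) = ∈-subsetOf⁻ NR? u∈D in
        ⊥-elim (v∉D (∈-subsetOf⁺ NR? (v∉K , λ y y∈Y y⇝v → Y↛u y y∈Y (snoc y⇝v u∉K (Adj-sym u~v)))))
      X⊆D : X ⊆ D
      X⊆D {x} x∈X = ∈-subsetOf⁺ NR? ((λ x∈K → proj₁ (K-avoids x x∈K) x∈X)
                                      , λ y y∈Y y⇝x → separates x y x∈X y∈Y (reverse y⇝x))
      D∩Y=∅ : ∀ y → y ∈ Y → y ∉ D
      D∩Y=∅ y y∈Y y∈D = let (y∉K , Y↛y) = ∈-subsetOf⁻ NR? y∈D in Y↛y y y∈Y (nil y∉K)

  InN-∪ : ∀ C D {v} → InN G (C ∪ D) v → InN G C v ⊎ InN G D v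
  InN-∪ C D (v∉C∪D , u , u∈C∪D , u~v) with x∈p∪q⁻ C D u∈C∪D
  ... | inj₁ u∈C = inj₁ (v∉C∪D ∘ x∈p∪q⁺ ∘ inj₁ , u , u∈C , u~v)
  ... | inj₂ u∈D = inj₂ (v∉C∪D ∘ x∈p∪q⁺ ∘ inj₂ , u , u∈D , u~v)

  InN-∩ : ∀ C D {v} → InN G (C ∩ D) v → InN G C v ⊎ InN G D v
  InN-∩ C D {v} (v∉C∩D , u , u∈C∩D , u~v) with v ∈? C | x∈p∩q⁻ C D u∈C∩D
  ... | yes v∈C | _ , u∈D = inj₂ ((λ v∈D → v∉C∩D (x∈p∩q⁺ (v∈C , v∈D))) , u , u∈D , u~v)
  ... | no v∉C  | u∈C , _ = inj₁ (v∉C , u , u∈C , u~v)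

  side-∪ : ∀ {C D} → Side C → Side D → Side (C ∪ D)
  side-∪ {C} {D} (X⊆C , C∩Y=∅ , NC∩Y=∅) (_ , D∩Y=∅ , ND∩Y=∅) =
    (λ x∈X → x∈p∪q⁺ (inj₁ (X⊆C x∈X)))
    , (λ y y∈Y y∈C∪D → [ C∩Y=∅ y y∈Y , D∩Y=∅ y y∈Y ]′ (x∈p∪q⁻ C D y∈C∪D))
    , λ v v∈N → [ NC∩Y=∅ v , ND∩Y=∅ v ]′ (InN-∪ C D v∈N)

  side-∩ : ∀ {C D} → Side C → Side D → Side (C ∩ D)
  side-∩ {C} {D} (X⊆C , C∩Y=∅ , NC∩Y=∅) (X⊆D , _ , ND∩Y=∅) =
    (λ x∈X → x∈p∩q⁺ (X⊆C x∈X , X⊆D x∈X))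
    , (λ y y∈Y y∈C∩D → C∩Y=∅ y y∈Y (proj₁ (x∈p∩q⁻ C D y∈C∩D)))
    , λ v v∈N → [ NC∩Y=∅ v , ND∩Y=∅ v ]′ (InN-∩ C D v∈N)

  nbhd-submodular : ∀ C D → ∣ nbhd (C ∩ D) ∣ + ∣ nbhd (C ∪ D) ∣ ≤ ∣ nbhd C ∣ + ∣ nbhd D ∣
  nbhd-submodular C D = ∣p∣+∣q∣-mono both either
    where
    -- A vertex outside C ∪ D with a neighbour in C ∩ D lies in both N(C) and N(D).
    both : nbhd (C ∩ D) ∩ nbhd (C ∪ D) ⊆ nbhd C ∩ nbhd D
    both v∈∩ with x∈p∩q⁻ (nbhd (C ∩ D)) (nbhd (C ∪ D)) v∈∩
    ... | v∈N∩ , v∈N∪ with ∈nbhd⁻ (C ∩ D) v∈N∩ | ∈nbhd⁻ (C ∪ D) v∈N∪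
    ...   | _ , u , u∈C∩D , u~v | v∉C∪D , _ with x∈p∩q⁻ C D u∈C∩D
    ...     | u∈C , u∈D = x∈p∩q⁺ ( ∈nbhd⁺ C (v∉C∪D ∘ x∈p∪q⁺ ∘ inj₁ , u , u∈C , u~v)
                                 , ∈nbhd⁺ D (v∉C∪D ∘ x∈p∪q⁺ ∘ inj₂ , u , u∈D , u~v))
    either : nbhd (C ∩ D) ∪ nbhd (C ∪ D) ⊆ nbhd C ∪ nbhd D
    either v∈∪ = x∈p∪q⁺ (Sum.map (∈nbhd⁺ C) (∈nbhd⁺ D)
      ([ InN-∩ C D ∘ ∈nbhd⁻ (C ∩ D) , InN-∪ C D ∘ ∈nbhd⁻ (C ∪ D) ]′
         (x∈p∪q⁻ (nbhd (C ∩ D)) (nbhd (C ∪ D)) v∈∪)))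

  Cover : Subset n → Subset n → Set
  Cover T C = Side C × T ⊆ C

  cover? : ∀ T C → Dec (Cover T C)
  cover? T C = side? C ×-dec (T ⊆? C)

  module CoverArgument (S : Subset n) (X∩Y=∅ : DisjointS G X Y)
                       (S⊆NX : ∀ v → v ∈ S → InN G X v) (S≁Y : ∀ s y → s ∈ S → y ∈ Y → ¬ Adj G s y)
                       (K₀ : Subset n) (K₀-smallest : SmallestSep G X Y K₀) where

    r : ℕ
    r = ∣ K₀ ∣

    r-minimum : MinSepSize G X Y r
    r-minimum = (K₀ , proj₁ K₀-smallest , refl) , proj₂ K₀-smallest

    r-unique : ∀ {r'} → MinSepSize G X Y r' → r' ≡ r
    r-unique ((K , K-sep , ∣K∣≡r') , r'-least) =
      ≤-antisym (r'-least K₀ (proj₁ K₀-smallest)) (subst (r ≤_) ∣K∣≡r' (proj₂ K₀-smallest K K-sep))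

    X∪S-covers-S : Cover S (X ∪ S)
    X∪S-covers-S = ((λ x∈X → x∈p∪q⁺ (inj₁ x∈X)) , X∪S∩Y=∅ , edge-avoids-Y) , λ s∈S → x∈p∪q⁺ (inj₂ s∈S)
      where
      no-X–Y-edge : ∀ {x y} → x ∈ X → y ∈ Y → ¬ Adj G x y
      no-X–Y-edge = sep⇒no-edge (proj₁ K₀-smallest)
      X∪S∩Y=∅ : ∀ y → y ∈ Y → y ∉ X ∪ S
      X∪S∩Y=∅ y y∈Y y∈X∪S with x∈p∪q⁻ X S y∈X∪S
      ... | inj₁ y∈X = X∩Y=∅ y y∈X y∈Y
      ... | inj₂ y∈S = let (_ , x , x∈X , x~y) = S⊆NX y y∈S in no-X–Y-edge x∈X y∈Y x~y
      edge-avoids-Y : ∀ v → InN G (X ∪ S) v → v ∉ Y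
      edge-avoids-Y v (_ , u , u∈X∪S , u~v) v∈Y with x∈p∪q⁻ X S u∈X∪S
      ... | inj₁ u∈X = no-X–Y-edge u∈X v∈Y u~v
      ... | inj₂ u∈S = S≁Y u v u∈S v∈Y u~v

    abstract
      least-cover : ∃[ C ] (Cover S C × (∀ C' → Cover S C' → ∣ nbhd C ∣ ≤ ∣ nbhd C' ∣))
      least-cover = minimiser (Cover S) (cover? S) (∣_∣ ∘ nbhd) X∪S-covers-S

    m : ℕ
    m = ∣ nbhd (proj₁ least-cover) ∣

    Tight : Subset n → Set
    Tight T = ∀ C → Cover T C → m ≤ ∣ nbhd C ∣

    S-tight : Tight S
    S-tight = proj₂ (proj₂ least-cover)

    -- A tight T ⊆ N(X) bounds every separator avoiding T: such a K contains N(D) for the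
    -- cover D = NR(G,Y,K) of T.
    tight⇒sep-bound : ∀ {T} → T ⊆ S → Tight T → ∀ K → Sep G X Y K → DisjointS G T K → m ≤ ∣ K ∣
    tight⇒sep-bound {T} T⊆S T-tight K K-sep K∩T=∅ =
      decidable-stable (m ≤? ∣ K ∣) (¬¬-map bound (NR-side K-sep))
      where
      bound : ∃[ D ] (Side D × nbhd D ⊆ K × (∀ {v} → v ∈ D → NR G Y K v)
                                         × (∀ {v} → NR G Y K v → v ∈ D))
            → m ≤ ∣ K ∣
      bound (D , D-side , ND⊆K , _ , NR⊆D) =
        ≤-trans (T-tight D (D-side , T⊆D)) (p⊆q⇒∣p∣≤∣q∣ ND⊆K)
        where
        T⊆D : T ⊆ D
        T⊆D {t} t∈T = NR⊆D (sep⇒NX-unreachable K-sep (S⊆NX t (T⊆S t∈T)) (K∩T=∅ t t∈T))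

    Optimal : Subset n → Set
    Optimal C = Cover S C × ∣ nbhd C ∣ ≤ m

    abstract
      largest-optimal : ∃[ C ] (Optimal C × (∀ C' → Optimal C' → ∣ C' ∣ ≤ ∣ C ∣))
      largest-optimal = largest Optimal (λ C → cover? S C ×-dec (∣ nbhd C ∣ ≤? m))
                                (proj₁ (proj₂ least-cover) , ≤-refl)

    C* : Subset n
    C* = proj₁ largest-optimal

    C*-covers : Cover S C*
    C*-covers = proj₁ (proj₁ (proj₂ largest-optimal))

    ∣NC*∣≡m : ∣ nbhd C* ∣ ≡ m
    ∣NC*∣≡m = ≤-antisym (proj₂ (proj₁ (proj₂ largest-optimal))) (S-tight C* C*-covers)

    C*-largest : ∀ D → Optimal D → ∣ D ∣ ≤ ∣ C* ∣
    C*-largest = proj₂ (proj₂ largest-optimal)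

    c : ℕ
    c = m ∸ r

    m≡r+c : m ≡ r + c
    m≡r+c = sym (m+[n∸m]≡n (subst (r ≤_) ∣NC*∣≡m (proj₂ K₀-smallest (nbhd C*) (side-sep (proj₁ C*-covers)))))

    NC*-excess : Excess G X Y (nbhd C*) c
    NC*-excess = side-sep (proj₁ C*-covers) , r , r-minimum , trans ∣NC*∣≡m m≡r+c

    tight⇒CE : ∀ {T} → T ⊆ S → Tight T → CE G X Y T c
    tight⇒CE {T} T⊆S T-tight =
      (nbhd C* , nbhd-disjoint (proj₂ C*-covers ∘ T⊆S) , NC*-excess)
      , λ { K e K∩T=∅ (K-sep , r' , r'-min , ∣K∣≡r'+e) →
              +-cancelˡ-≤ r c e (begin
                r + c    ≡⟨ sym m≡r+c ⟩
                m        ≤⟨ tight⇒sep-bound T⊆S T-tight K K-sep K∩T=∅ ⟩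
                ∣ K ∣    ≡⟨ ∣K∣≡r'+e ⟩
                r' + e   ≡⟨ cong (_+ e) (r-unique r'-min) ⟩
                r + e    ∎) }
      where open ≤-Reasoning

    -- N(C*) is a minimal separator: a proper subset would avoid S and be smaller than m.
    NC*-minimal : ∀ K → K ⊂ nbhd C* → ¬ Sep G X Y K
    NC*-minimal K K⊂NC* K-sep = <⇒≱ (p⊂q⇒∣p∣<∣q∣ K⊂NC*) (begin
      ∣ nbhd C* ∣  ≡⟨ ∣NC*∣≡m ⟩
      m            ≤⟨ tight⇒sep-bound id S-tight K K-sep K∩S=∅ ⟩
      ∣ K ∣        ∎)
      where
      open ≤-Reasoning
      K∩S=∅ : DisjointS G S K
      K∩S=∅ v v∈S v∈K = nbhd-disjoint (proj₂ C*-covers) v v∈S (proj₁ K⊂NC* v∈K)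

    -- N(C*) is important: a separator K > N(C*) with |K| ≤ m would give the cover
    -- NR(G,Y,K) ⊋ C* of S attaining m, against the maximality of C*.
    NC*-important : ImportantSep G X Y (nbhd C*)
    NC*-important = (side-sep (proj₁ C*-covers) , NC*-minimal) , no-greater
      where
      no-greater : ∀ K → Sep G X Y K → Greater G Y K (nbhd C*) → ¬ (∣ K ∣ ≤ ∣ nbhd C* ∣)
      no-greater K K-sep (NR-grows , w , w∈NR , w∉NR*) ∣K∣≤ = NR-side K-sep
        λ { (D , D-side , ND⊆K , _ , NR⊆D) →
          let C*⊆D : C* ⊆ D
              C*⊆D v∈C* = NR⊆D (NR-grows _ (side⊆NR (proj₁ C*-covers) v∈C*))
              D-optimal : Optimal D
              D-optimal = (D-side , C*⊆D ∘ proj₂ C*-covers)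
                        , ≤-trans (p⊆q⇒∣p∣≤∣q∣ ND⊆K) (subst (∣ K ∣ ≤_) ∣NC*∣≡m ∣K∣≤)
              C*⊂D : C* ⊂ D
              C*⊂D = C*⊆D , w , NR⊆D w∈NR , λ w∈C* → w∉NR* (side⊆NR (proj₁ C*-covers) w∈C*)
          in <⇒≱ (p⊂q⇒∣p∣<∣q∣ C*⊂D) (C*-largest D D-optimal) }

    tight⇒important-witness : ∀ {T} → T ⊆ S → Tight T → ImportantWitness G X Y T (nbhd C*)
    tight⇒important-witness T⊆S T-tight =
      ( side-sep (proj₁ C*-covers) , nbhd-disjoint (proj₂ C*-covers ∘ T⊆S)
      , c , tight⇒CE T⊆S T-tight , NC*-excess )
      , NC*-important

    Loose : Subset n → Set
    Loose T = ∃[ C ] (Cover T C × ∣ nbhd C ∣ < m)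

    loose? : ∀ T → Dec (Loose T)
    loose? T = anySubset? (λ C → cover? T C ×-dec (∣ nbhd C ∣ <? m))

    loose⇒¬tight : ∀ {T} → Loose T → ¬ Tight T
    loose⇒¬tight (C , C-covers , ∣NC∣<m) T-tight = <⇒≱ ∣NC∣<m (T-tight C C-covers)

    ¬loose⇒tight : ∀ {T} → ¬ Loose T → Tight T
    ¬loose⇒tight not-loose C C-covers = ≮⇒≥ λ ∣NC∣<m → not-loose (C , C-covers , ∣NC∣<m)

    tight? : ∀ T → Dec (Tight T)
    tight? T with loose? T
    ... | yes T-loose  = no (loose⇒¬tight T-loose)
    ... | no not-loose = yes (¬loose⇒tight not-loose)

    ¬tight⇒loose : ∀ T → ¬ Tight T → Loose T
    ¬tight⇒loose T not-tight = decidable-stable (loose? T) (not-tight ∘ ¬loose⇒tight)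

    -- For A ⊆ T there is an
    -- X-side containing T ∖ A with |N(C)| + |A| ≤ m: for s ∈ A intersect the side for A - s
    -- with a cover of T - s; their union covers T, so submodularity does the counting.
    module Uncrossing {T : Subset n} (T⊆S : T ⊆ S) (T-tight : Tight T)
                      (T-s-loose : ∀ {s} → s ∈ T → Loose (T - s)) where

      uncross : ∀ k A → A ⊆ T → ∣ A ∣ ≤ k
              → ∃[ C ] (Side C × (∀ {v} → v ∈ T → v ∉ A → v ∈ C) × ∣ nbhd C ∣ + ∣ A ∣ ≤ m)
      uncross k A A⊆T ∣A∣≤k with nonempty? A
      ... | no A-empty =
        C* , proj₁ C*-covers , (λ v∈T _ → proj₂ C*-covers (T⊆S v∈T))
        , subst (λ a → ∣ nbhd C* ∣ + a ≤ m) (sym ∣A∣≡0) (≤-reflexive (trans (+-identityʳ _) ∣NC*∣≡m))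
        where
        ∣A∣≡0 : ∣ A ∣ ≡ 0
        ∣A∣≡0 = trans (cong ∣_∣ (Empty-unique A-empty)) (∣⊥∣≡0 n)
      uncross zero A A⊆T ∣A∣≤0 | yes (s , s∈A) = ⊥-elim (member⇒∣p∣≰0 s∈A ∣A∣≤0)
      uncross (suc k) A A⊆T ∣A∣≤k | yes (s , s∈A)
        with uncross k (A - s) (A⊆T ∘ A-s⊆A) (∣p-x∣≤ s∈A ∣A∣≤k)
           | T-s-loose (A⊆T s∈A)
        where
        A-s⊆A : A - s ⊆ A
        A-s⊆A = p─q⊆p A ⁅ s ⁆
      ... | C₁ , C₁-side , T∖[A-s]⊆C₁ , bound₁ | C₂ , (C₂-side , T-s⊆C₂) , ∣NC₂∣<m =
        C₁ ∩ C₂ , side-∩ C₁-side C₂-side , T∖A⊆C₁∩C₂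
        , ≤-trans (+-monoʳ-≤ ∣ nbhd (C₁ ∩ C₂) ∣ (∣p∣≤1+∣p-x∣ A s))
                  (uncross-arith bound₁ ∣NC₂∣<m (T-tight (C₁ ∪ C₂) (side-∪ C₁-side C₂-side , T⊆C₁∪C₂))
                                 (nbhd-submodular C₁ C₂))
        where
        -- s itself lies in C₁ (it is not in A - s), every other vertex of T lies in C₂.
        T⊆C₁∪C₂ : T ⊆ C₁ ∪ C₂
        T⊆C₁∪C₂ {v} v∈T with v ≟ s
        ... | yes refl = x∈p∪q⁺ (inj₁ (T∖[A-s]⊆C₁ v∈T (x∉p-x A v)))
        ... | no v≢s   = x∈p∪q⁺ (inj₂ (T-s⊆C₂ (x∈p∧x≢y⇒x∈p-y v∈T v≢s)))
        T∖A⊆C₁∩C₂ : ∀ {v} → v ∈ T → v ∉ A → v ∈ C₁ ∩ C₂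
        T∖A⊆C₁∩C₂ v∈T v∉A = x∈p∩q⁺ ( T∖[A-s]⊆C₁ v∈T (v∉A ∘ p─q⊆p A ⁅ s ⁆)
                                   , T-s⊆C₂ (x∈p∧x≢y⇒x∈p-y v∈T λ { refl → v∉A s∈A }))

      -- Taking A = T: some separator N(C) has |N(C)| + |T| ≤ m = r + c.
      small : ∣ T ∣ ≤ c
      small with uncross n T (λ v∈T → v∈T) (∣p∣≤n T)
      ... | C , C-side , _ , ∣NC∣+∣T∣≤m = +-cancelˡ-≤ r _ _ (begin
        r + ∣ T ∣          ≤⟨ +-monoˡ-≤ ∣ T ∣ (proj₂ K₀-smallest (nbhd C) (side-sep C-side)) ⟩
        ∣ nbhd C ∣ + ∣ T ∣ ≤⟨ ∣NC∣+∣T∣≤m ⟩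
        m                  ≡⟨ m≡r+c ⟩
        r + c              ∎)
        where open ≤-Reasoning

    -- Greedy shrinking: drop vertices of a tight T ⊆ S while tightness is kept; when no
    -- vertex can be dropped, uncrossing bounds the size by c.
    shrink : ∀ k {T} → T ⊆ S → ∣ T ∣ ≤ k → Tight T → ∃[ S' ] (S' ⊆ S × Tight S' × ∣ S' ∣ ≤ c)
    shrink k {T} T⊆S ∣T∣≤k T-tight with any? (λ s → (s ∈? T) ×-dec tight? (T - s))
    ... | no stuck = T , T⊆S , T-tight ,
      Uncrossing.small T⊆S T-tight λ {s} s∈T → ¬tight⇒loose (T - s) λ T-s-tight → stuck (s , s∈T , T-s-tight)
    shrink zero T⊆S ∣T∣≤0 T-tight | yes (s , s∈T , _) = ⊥-elim (member⇒∣p∣≰0 s∈T ∣T∣≤0)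
    shrink (suc k) {T} T⊆S ∣T∣≤k T-tight | yes (s , s∈T , T-s-tight) =
      shrink k (T⊆S ∘ p─q⊆p T ⁅ s ⁆) (∣p-x∣≤ s∈T ∣T∣≤k) T-s-tight

    small-tight-subset : ∃[ S' ] (S' ⊆ S × Tight S' × ∣ S' ∣ ≤ c)
    small-tight-subset = shrink n id (∣p∣≤n S) S-tight

lemma12 : {n : ℕ} (G : Graph n) (X Y S : Subset n)
    → DisjointS G X Y
    → Normalized G X Y
    → (∀ v → v ∈ S → InN G X v)
    → (∀ s y → s ∈ S → y ∈ Y → ¬ Adj G s y)
    → ∃[ S' ] (S' ⊆ S × ∃[ c ] (CE G X Y S c × ∣ S' ∣ ≤ c)
         × ∃[ K ] (ImportantWitness G X Y S K × ImportantWitness G X Y S' K))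
lemma12 G X Y S X∩Y=∅ ((K₀ , _ , K₀-smallest) , _) S⊆NX S≁Y =
  let (S' , S'⊆S , S'-tight , ∣S'∣≤c) = small-tight-subset in
  S' , S'⊆S , c , (tight⇒CE id S-tight , ∣S'∣≤c)
  , nbhd C* , tight⇒important-witness id S-tight , tight⇒important-witness S'⊆S S'-tight
  where
  open Sides G X Y
  open CoverArgument S X∩Y=∅ S⊆NX S≁Y K₀ K₀-smallest
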